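{- Let $G=(V,E)$ be a graph with $n$ vertices. Let $I_1,\dots,I_k$ be a greedy coloring: $I_1$ is a maximum-size independent set of $G$, and for $j\ge1$, $I_{j+1}$ is a maximum-size independent set of $G-I_1-\cdots-I_j$, stopping when $I_1\cup\cdots\cup I_k=V$. Consider the polytope $Q\subseteq\mathbb R^V\times\mathbb R^k$ defined by $$0\le x_v\le y_j\le1\quad\forall j\in[k],\ v\in I_j,\qquad \sum_{j=1}^k y_j\le\lfloor2\sqrt n\rfloor.$$ Then for every induced subgraph $H$ of $G$, $$\max\Big\{\sum_{v\in V(H)}x_v : (x,y)\in Q\Big\}\;\le\;\lfloor2\sqrt n\rfloor\cdot\alpha(H),$$ where $\alpha(H)$ is the maximum size of an independent set of $H$.
   Formalization: The points of the polytope Q have rational coordinates, lying in ℚ^V × ℚ^k rather than $\mathbb R^V\times\mathbb R^k$. -}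

module Defs where

open import Data.Nat using (ℕ; zero; suc; _≤_; _<_; _*_)
open import Data.Fin using (Fin; toℕ)
import Data.Fin as Fin
open import Data.Fin.Subset using (Subset; _∈_; ∣_∣)
open import Data.Vec using (lookup)
open import Data.Bool using (if_then_else_)
open import Data.Integer using (+_)
open import Data.Rational using (ℚ; 0ℚ; _/_)
import Data.Rational as Q
open import Data.Product using (_×_; ∃; Σ)
open import Relation.Nullary using (¬_)
open import Relation.Binary.PropositionalEquality using (_≡_)

record SimpleGraph (n : ℕ) : Set₁ where
  field
    Adj    : Fin n → Fin n → Set
    sym    : ∀ {u v} → Adj u v → Adj v u
    irrefl : ∀ {v} → ¬ Adj v v
open SimpleGraph public

Independent : ∀ {n} → SimpleGraph n → Subset n → Set
Independent G S = ∀ u v → u ∈ S → v ∈ S → ¬ Adj G u v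

IsMaxIndepIn : ∀ {n} → SimpleGraph n → (Fin n → Set) → Subset n → Set
IsMaxIndepIn G W S =
  (∀ v → v ∈ S → W v) × Independent G S ×
  (∀ T → (∀ v → v ∈ T → W v) → Independent G T → ∣ T ∣ ≤ ∣ S ∣)

-- Vertices not in I_1 ∪ … ∪ I_{j} (0-indexed: not in any I i with i < j).
Remaining : ∀ {n k} → (Fin k → Subset n) → Fin k → Fin n → Set
Remaining I j v = ¬ (∃ λ i → toℕ i < toℕ j × v ∈ I i)

-- I_1,…,I_k is a greedy coloring of G: each I_j is a maximum independent
-- set of G - I_1 - … - I_{j-1}; the process runs while vertices remain
-- (remaining set nonempty at each step) and stops when everything is covered.
IsGreedyColoring : ∀ {n} → SimpleGraph n → (k : ℕ) → (Fin k → Subset n) → Set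
IsGreedyColoring {n} G k I =
  (∀ j → IsMaxIndepIn G (Remaining I j) (I j)) ×
  (∀ j → ∃ λ v → Remaining I j v) ×
  (∀ (v : Fin n) → ∃ λ j → v ∈ I j)

IsIndepNumber : ∀ {n} → SimpleGraph n → Subset n → ℕ → Set
IsIndepNumber G U a =
  Σ (Subset _) λ S → IsMaxIndepIn G (λ v → v ∈ U) S × ∣ S ∣ ≡ a

-- m = ⌊2√n⌋, i.e. m is the largest natural with m² ≤ 4n.
IsFloorTwoSqrt : ℕ → ℕ → Set
IsFloorTwoSqrt n m = m * m ≤ 4 * n × 4 * n < suc m * suc m

sumℚ : ∀ {n} → (Fin n → ℚ) → ℚ
sumℚ {zero}  f = 0ℚ
sumℚ {suc n} f = f Fin.zero Q.+ sumℚ (λ i → f (Fin.suc i))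

sumOver : ∀ {n} → Subset n → (Fin n → ℚ) → ℚ
sumOver U x = sumℚ (λ v → if lookup U v then x v else 0ℚ)

ℕtoℚ : ℕ → ℚ
ℕtoℚ m = + m / 1

InQ : ∀ {n k} → (Fin k → Subset n) → ℕ → (Fin n → ℚ) → (Fin k → ℚ) → Set
InQ I c x y =
  (∀ j v → v ∈ I j → 0ℚ Q.≤ x v × x v Q.≤ y j × y j Q.≤ Q.1ℚ) ×
  sumℚ y Q.≤ ℕtoℚ c

-- Every vertex v lies in some colour class I_j, where x_v ≤ y_j; since all y_j are
-- nonnegative (each class is nonempty), Σ_{v ∈ H} x_v ≤ Σ_j |V(H) ∩ I_j| · y_j.
-- Each V(H) ∩ I_j is independent in H, so |V(H) ∩ I_j| ≤ α(H), and Σ_j y_j ≤ c.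
module Submission where

open import Defs hiding (sym)
open import Data.Nat using (ℕ; zero; suc; _*_; s≤s; z≤n)
import Data.Nat as ℕ
open import Data.Nat.Properties using (*-comm)
open import Data.Nat.Divisibility using (∣1⇒≡1)
import Data.Integer as ℤ
import Data.Integer.Properties as ℤ
open import Data.Fin using (Fin; zero; suc)
open import Data.Fin.Subset using (Subset; _∈_; _∉_; _⊆_; _∩_; ∣_∣; ⁅_⁆; Nonempty; inside; outside)
open import Data.Fin.Subset.Properties using (_∈?_; x∈⁅y⁆⇒x≡y; ∣⁅x⁆∣≡1; p∩q⊆p; p∩q⊆q; x∈p∩q⁺)
open import Data.Vec using ([]; _∷_; lookup; here; there)
open import Data.Vec.Properties using ([]=⇒lookup; lookup⇒[]=)
open import Data.Bool using (true; false; if_then_else_)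
open import Data.Rational using (ℚ; 0ℚ; _≤_; _+_; mkℚ; _/_)
open import Data.Rational.Properties
  using (≤-refl; ≤-trans; +-mono-≤; +-monoˡ-≤; +-monoʳ-≤; +-identityˡ; +-identityʳ;
         normalize-coprime; +-0-monoid; +-0-commutativeMonoid; module ≤-Reasoning)
open import Data.Product using (_,_; proj₁; proj₂; ∃)
open import Function using (const)
open import Relation.Nullary using (yes; no; contradiction)
open import Relation.Binary.PropositionalEquality using (_≡_; refl; cong; cong₂; subst; subst₂; trans; sym)

open import Algebra.Properties.CommutativeMonoid.Sum +-0-commutativeMonoid
  using (sum; sum-syntax; ∑-comm; ∑-distrib-+; sum-cong-≗; sum-replicate-zero)
open import Algebra.Properties.Monoid.Mult +-0-monoid using (_×_)

ℕtoℚ≡mkℚ : ∀ m → ℕtoℚ m ≡ mkℚ (ℤ.+ m) 0 (λ {i} i∣m,1 → ∣1⇒≡1 (proj₂ i∣m,1))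
ℕtoℚ≡mkℚ m = normalize-coprime _

-- After unfolding to mkℚ, the right-hand side reduces to (m · 1 + n · 1) / 1.
ℕtoℚ-+ : ∀ m n → ℕtoℚ (m ℕ.+ n) ≡ ℕtoℚ m + ℕtoℚ n
ℕtoℚ-+ m n rewrite ℕtoℚ≡mkℚ m | ℕtoℚ≡mkℚ n =
  cong (_/ 1) (sym (trans (cong₂ ℤ._+_ (ℤ.*-identityʳ (ℤ.+ m)) (ℤ.*-identityʳ (ℤ.+ n))) (ℤ.pos-+ m n)))

×-ℕtoℚ : ∀ m n → m × ℕtoℚ n ≡ ℕtoℚ (m * n)
×-ℕtoℚ zero    n = refl
×-ℕtoℚ (suc m) n = trans (cong (ℕtoℚ n +_) (×-ℕtoℚ m n)) (sym (ℕtoℚ-+ n (m * n)))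

p≤p+q : ∀ {p q} → 0ℚ ≤ q → p ≤ p + q
p≤p+q {p} {q} 0≤q = subst (_≤ p + q) (+-identityʳ p) (+-monoʳ-≤ p 0≤q)

p≤q+p : ∀ {p q} → 0ℚ ≤ q → p ≤ q + p
p≤q+p {p} {q} 0≤q = subst (_≤ q + p) (+-identityˡ p) (+-monoˡ-≤ p 0≤q)

×-nonneg : ∀ {q} → 0ℚ ≤ q → ∀ m → 0ℚ ≤ m × q
×-nonneg 0≤q zero    = ≤-refl
×-nonneg 0≤q (suc m) = ≤-trans (×-nonneg 0≤q m) (p≤q+p 0≤q)

×-monoˡ-≤ : ∀ {q} → 0ℚ ≤ q → ∀ {m n} → m ℕ.≤ n → m × q ≤ n × q
×-monoˡ-≤ 0≤q {n = n} z≤n = ×-nonneg 0≤q n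
×-monoˡ-≤ {q} 0≤q (s≤s m≤n) = +-monoʳ-≤ q (×-monoˡ-≤ 0≤q m≤n)

×-monoʳ-≤ : ∀ m {p q} → p ≤ q → m × p ≤ m × q
×-monoʳ-≤ zero    p≤q = ≤-refl
×-monoʳ-≤ (suc m) p≤q = +-mono-≤ p≤q (×-monoʳ-≤ m p≤q)

sumℚ≡sum : ∀ {n} (f : Fin n → ℚ) → sumℚ f ≡ sum f
sumℚ≡sum {zero}  f = refl
sumℚ≡sum {suc n} f = cong (f zero +_) (sumℚ≡sum (λ i → f (suc i)))

sum-mono : ∀ {n} {f g : Fin n → ℚ} → (∀ i → f i ≤ g i) → sum f ≤ sum g
sum-mono {zero}  f≤g = ≤-refl
sum-mono {suc n} f≤g = +-mono-≤ (f≤g zero) (sum-mono (λ i → f≤g (suc i)))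

sum-nonneg : ∀ {n} {f : Fin n → ℚ} → (∀ i → 0ℚ ≤ f i) → 0ℚ ≤ sum f
sum-nonneg {n} {f} 0≤f = subst (_≤ sum f) (sum-replicate-zero n) (sum-mono 0≤f)

≤-sum : ∀ {n} {f : Fin n → ℚ} → (∀ i → 0ℚ ≤ f i) → ∀ i → f i ≤ sum f
≤-sum 0≤f zero    = p≤p+q (sum-nonneg (λ i → 0≤f (suc i)))
≤-sum 0≤f (suc i) = ≤-trans (≤-sum (λ i → 0≤f (suc i)) i) (p≤q+p (0≤f zero))

∑-distrib-× : ∀ {n} m (f : Fin n → ℚ) → ∑[ i < n ] (m × f i) ≡ m × sum f
∑-distrib-× {n} zero    f = sum-replicate-zero n
∑-distrib-×     (suc m) f = trans (∑-distrib-+ f (λ i → m × f i)) (cong (sum f +_) (∑-distrib-× m f))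

restrict : ∀ {n} → Subset n → (Fin n → ℚ) → Fin n → ℚ
restrict S f v = if lookup S v then f v else 0ℚ

restrict-∈ : ∀ {n} {S : Subset n} {v} (f : Fin n → ℚ) → v ∈ S → restrict S f v ≡ f v
restrict-∈ f v∈S rewrite []=⇒lookup v∈S = refl

restrict-∉ : ∀ {n} {S : Subset n} {v} (f : Fin n → ℚ) → v ∉ S → restrict S f v ≡ 0ℚ
restrict-∉ {S = S} {v} f v∉S with lookup S v in eq
... | true  = contradiction (lookup⇒[]= v S eq) v∉S
... | false = refl

restrict-nonneg : ∀ {n} (S : Subset n) {f : Fin n → ℚ} → (∀ v → 0ℚ ≤ f v) → ∀ v → 0ℚ ≤ restrict S f v
restrict-nonneg S {f} 0≤f v with v ∈? S
... | yes v∈S = subst (0ℚ ≤_) (sym (restrict-∈ f v∈S)) (0≤f v)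
... | no  v∉S = subst (0ℚ ≤_) (sym (restrict-∉ f v∉S)) ≤-refl

sum-restrict-const : ∀ {n} (S : Subset n) q → sum (restrict S (const q)) ≡ ∣ S ∣ × q
sum-restrict-const []            q = refl
sum-restrict-const (inside  ∷ S) q = cong (q +_) (sum-restrict-const S q)
sum-restrict-const (outside ∷ S) q = trans (+-identityˡ _) (sum-restrict-const S q)

1≤∣p∣⇒nonempty : ∀ {n} (p : Subset n) → 1 ℕ.≤ ∣ p ∣ → Nonempty p
1≤∣p∣⇒nonempty (inside  ∷ p) _ = zero , here
1≤∣p∣⇒nonempty (outside ∷ p) 1≤∣p∣ with 1≤∣p∣⇒nonempty p 1≤∣p∣
... | v , v∈p = suc v , there v∈p

⁅⁆-independent : ∀ {n} (G : SimpleGraph n) v → Independent G ⁅ v ⁆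
⁅⁆-independent G v u w u∈ w∈ adj = irrefl G (subst₂ (Adj G) (x∈⁅y⁆⇒x≡y v u∈) (x∈⁅y⁆⇒x≡y v w∈) adj)

independent-⊆ : ∀ {n} (G : SimpleGraph n) {S T} → T ⊆ S → Independent G S → Independent G T
independent-⊆ G T⊆S indS u w u∈T w∈T = indS u w (T⊆S u∈T) (T⊆S w∈T)

maxIndep-nonempty : ∀ {n} (G : SimpleGraph n) {W S} → IsMaxIndepIn G W S → ∀ {v} → W v → Nonempty S
maxIndep-nonempty G {W} {S} (_ , _ , maximal) {v} v∈W =
  1≤∣p∣⇒nonempty S (subst (ℕ._≤ ∣ S ∣) (∣⁅x⁆∣≡1 v) (maximal ⁅ v ⁆ ⁅v⁆⊆W (⁅⁆-independent G v)))
  where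
  ⁅v⁆⊆W : ∀ u → u ∈ ⁅ v ⁆ → W u
  ⁅v⁆⊆W u u∈⁅v⁆ = subst W (sym (x∈⁅y⁆⇒x≡y v u∈⁅v⁆)) v∈W

greedy-class-nonempty : ∀ {n} (G : SimpleGraph n) {k I} → IsGreedyColoring G k I → ∀ j → Nonempty (I j)
greedy-class-nonempty G (maxIndep , remaining , _) j = maxIndep-nonempty G (maxIndep j) (proj₂ (remaining j))

InQ-y-nonneg : ∀ {n k} {I : Fin k → Subset n} c x y →
               (∀ j → Nonempty (I j)) → InQ I c x y → ∀ j → 0ℚ ≤ y j
InQ-y-nonneg _ _ _ nonempty (box , _) j with nonempty j
... | v , v∈Ij with box j v v∈Ij
...   | 0≤xv , xv≤yj , _ = ≤-trans 0≤xv xv≤yj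

sumOver-≤-∑-∣∩∣× : ∀ {n k} (I : Fin k → Subset n) (x : Fin n → ℚ) (y : Fin k → ℚ) →
                   (∀ v → ∃ λ j → v ∈ I j) → (∀ j → 0ℚ ≤ y j) → (∀ j v → v ∈ I j → x v ≤ y j) →
                   ∀ U → sumOver U x ≤ ∑[ j < k ] (∣ U ∩ I j ∣ × y j)
sumOver-≤-∑-∣∩∣× {n} {k} I x y cover 0≤y x≤y U = begin
  sumOver U x
    ≡⟨ sumℚ≡sum (restrict U x) ⟩
  sum (restrict U x)
    ≤⟨ sum-mono pointwise ⟩
  ∑[ v < n ] ∑[ j < k ] restrict (U ∩ I j) (const (y j)) v
    ≡⟨ ∑-comm (λ v j → restrict (U ∩ I j) (const (y j)) v) ⟩
  ∑[ j < k ] sum (restrict (U ∩ I j) (const (y j)))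
    ≡⟨ sum-cong-≗ (λ j → sum-restrict-const (U ∩ I j) (y j)) ⟩
  ∑[ j < k ] (∣ U ∩ I j ∣ × y j)
    ∎
  where
  open ≤-Reasoning
  terms-nonneg : ∀ v j → 0ℚ ≤ restrict (U ∩ I j) (const (y j)) v
  terms-nonneg v j = restrict-nonneg (U ∩ I j) (λ _ → 0≤y j) v
  pointwise : ∀ v → restrict U x v ≤ ∑[ j < k ] restrict (U ∩ I j) (const (y j)) v
  pointwise v with v ∈? U | cover v
  ... | no  v∉U | _ = subst (_≤ _) (sym (restrict-∉ x v∉U)) (sum-nonneg (terms-nonneg v))
  ... | yes v∈U | j , v∈Ij = begin
    restrict U x v                                 ≡⟨ restrict-∈ x v∈U ⟩
    x v                                            ≤⟨ x≤y j v v∈Ij ⟩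
    y j                                            ≡⟨ restrict-∈ (const (y j)) (x∈p∩q⁺ (v∈U , v∈Ij)) ⟨
    restrict (U ∩ I j) (const (y j)) v             ≤⟨ ≤-sum (terms-nonneg v) j ⟩
    ∑[ j < k ] restrict (U ∩ I j) (const (y j)) v  ∎

lemma6 : ∀ {n} (G : SimpleGraph n) (k : ℕ) (I : Fin k → Subset n) → IsGreedyColoring G k I → (c : ℕ) → IsFloorTwoSqrt n c → (U : Subset n) (a : ℕ) → IsIndepNumber G U a → (x : Fin n → ℚ) (y : Fin k → ℚ) → InQ I c x y → sumOver U x ≤ ℕtoℚ (c * a)
lemma6 G k I greedy@(maxIndep , _ , cover) c _ U _ (S , (_ , _ , maximal) , refl) x y inQ@(box , ∑y≤c) = begin
  sumOver U x                     ≤⟨ sumOver-≤-∑-∣∩∣× I x y cover 0≤y x≤y U ⟩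
  ∑[ j < k ] (∣ U ∩ I j ∣ × y j)  ≤⟨ sum-mono (λ j → ×-monoˡ-≤ (0≤y j) (∣U∩I∣≤α j)) ⟩
  ∑[ j < k ] (∣ S ∣ × y j)        ≡⟨ ∑-distrib-× ∣ S ∣ y ⟩
  ∣ S ∣ × sum y                   ≤⟨ ×-monoʳ-≤ ∣ S ∣ (subst (_≤ ℕtoℚ c) (sumℚ≡sum y) ∑y≤c) ⟩
  ∣ S ∣ × ℕtoℚ c                  ≡⟨ ×-ℕtoℚ ∣ S ∣ c ⟩
  ℕtoℚ (∣ S ∣ * c)                ≡⟨ cong ℕtoℚ (*-comm ∣ S ∣ c) ⟩
  ℕtoℚ (c * ∣ S ∣)                ∎
  where
  open ≤-Reasoning
  0≤y : ∀ j → 0ℚ ≤ y j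
  0≤y = InQ-y-nonneg c x y (greedy-class-nonempty G greedy) inQ
  x≤y : ∀ j v → v ∈ I j → x v ≤ y j
  x≤y j v v∈Ij = proj₁ (proj₂ (box j v v∈Ij))
  ∣U∩I∣≤α : ∀ j → ∣ U ∩ I j ∣ ℕ.≤ ∣ S ∣
  ∣U∩I∣≤α j = maximal (U ∩ I j) (λ _ → p∩q⊆p U (I j))
                (independent-⊆ G (p∩q⊆q U (I j)) (proj₁ (proj₂ (maxIndep j))))
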